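{- The cubeplex $\Gamma_1$, the twinplex $\Gamma_2$ and the complete bipartite graph $K_{3,3}$ are simply bad.
   Context: The cubeplex $\Gamma_1$ is the graph on vertices $a,b,c,d,e,f,g,h,i,j,k,l$ whose edges are those of the $12$-cycle $(a,b,c,d,e,f,g,h,i,j,k,l)$ together with the chords $ad, bg, ci, ej, fl, hk$. The twinplex $\Gamma_2$ is the graph on the same vertex set whose edges are those of the $12$-cycle $(a,b,c,d,e,f,g,h,i,j,k,l)$ together with the chords $ai, bf, cj, dh, el, gk$. For a graph $G$ with a $1$-factor $F$: a cycle $C$ is $F$-alternating if $|E(C)|=2|E(F)\cap E(C)|$; in an orientation of $G$ an even cycle $C$ is evenly (resp. oddly) oriented if, for either direction of traversal, the number of edges of $C$ directed along the traversal is even (resp. odd); a zero-sum $F$-set is a finite family $\{C_1,\ldots,C_k\}$ of $F$-alternating cycles such that every edge of $G$ lies in an even number of its members, and it is an odd $F$-set if $k$ is odd. A graph $G$ is simply bad if it has a $1$-factor $F$ such that $G$ has an odd $F$-set $\mathcal{A}$ and an orientation in which every member of $\mathcal{A}$ is evenly oriented. -}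

module Defs where

open import Data.Nat using (ℕ; zero; suc; _+_; _*_; _≤_)
open import Data.Fin using (Fin; #_)
open import Data.Fin.Properties using () renaming (_≟_ to _≟ᶠ_)
open import Data.Bool using (Bool; true; false; not)
open import Data.List using (List; []; _∷_; _++_; zipWith; length; filter)
open import Data.List.Relation.Unary.All using (All)
open import Data.List.Relation.Unary.Any using (Any)
open import Data.List.Relation.Unary.AllPairs using (AllPairs)
open import Data.List.Relation.Unary.Unique.Propositional using (Unique)
open import Data.List.Membership.Propositional using (_∈_)
open import Data.Product using (Σ; ∃; ∃-syntax; _×_; _,_; proj₁; proj₂)
open import Data.Sum using (_⊎_)
open import Relation.Binary.PropositionalEquality using (_≡_; _≢_)
open import Relation.Nullary using (¬_; Dec; yes; no)
open import Relation.Nullary.Decidable using (_⊎-dec_)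
open import Data.List.Membership.DecPropositional using () renaming (_∈?_ to ∈?-with)
open import Data.Product.Properties using (≡-dec)

Even : ℕ → Set
Even m = ∃[ j ] m ≡ j + j

Odd : ℕ → Set
Odd m = ∃[ j ] m ≡ suc (j + j)

-- Finite (simple) graphs on vertex set Fin n, given by an edge list.
-- Each undirected edge {u,v} is listed once as an ordered pair (u , v).

record Graph (n : ℕ) : Set where
  field
    edges : List (Fin n × Fin n)
open Graph public

Adj : ∀ {n} → Graph n → Fin n → Fin n → Set
Adj G u v = ((u , v) ∈ edges G) ⊎ ((v , u) ∈ edges G)

-- 1-factors (perfect matchings), given by the partner map μ:
-- the edge set of F is { {v , μ v} }.

record OneFactor {n} (G : Graph n) : Set where
  field
    partner     : Fin n → Fin n
    involutive  : ∀ v → partner (partner v) ≡ v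
    no-fix      : ∀ v → partner v ≢ v
    is-edge     : ∀ v → Adj G v (partner v)
open OneFactor public

-- A cycle is given by its cyclic vertex sequence v₀ … v_{L-1}
-- (distinct vertices, L ≥ 3, consecutive vertices adjacent, including
-- v_{L-1} v₀).

cycPairs : ∀ {n} → List (Fin n) → List (Fin n × Fin n)
cycPairs []       = []
cycPairs (v ∷ vs) = zipWith _,_ (v ∷ vs) (vs ++ (v ∷ []))

record Cycle {n} (G : Graph n) : Set where
  field
    verts    : List (Fin n)
    distinct : Unique verts
    long     : 3 ≤ length verts
    adjacent : All (λ p → Adj G (proj₁ p) (proj₂ p)) (cycPairs verts)
open Cycle public

EdgeOf : ∀ {n} {G : Graph n} → Fin n → Fin n → Cycle G → Set
EdgeOf u v C = ((u , v) ∈ cycPairs (verts C)) ⊎ ((v , u) ∈ cycPairs (verts C))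

edgeOf? : ∀ {n} {G : Graph n} (u v : Fin n) (C : Cycle G) → Dec (EdgeOf u v C)
edgeOf? u v C = ∈?-with (≡-dec _≟ᶠ_ _≟ᶠ_) (u , v) (cycPairs (verts C))
          ⊎-dec ∈?-with (≡-dec _≟ᶠ_ _≟ᶠ_) (v , u) (cycPairs (verts C))

numEdges : ∀ {n} {G : Graph n} → Cycle G → ℕ
numEdges C = length (cycPairs (verts C))

numFEdges : ∀ {n} {G : Graph n} → OneFactor G → Cycle G → ℕ
numFEdges F C = length (filter (λ p → partner F (proj₁ p) ≟ᶠ proj₂ p) (cycPairs (verts C)))

Alternating : ∀ {n} {G : Graph n} → OneFactor G → Cycle G → Set
Alternating F C = numEdges C ≡ 2 * numFEdges F C

SameCycle : ∀ {n} {G : Graph n} → Cycle G → Cycle G → Set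
SameCycle C D = ∀ u v → (EdgeOf u v C → EdgeOf u v D) × (EdgeOf u v D → EdgeOf u v C)

-- Orientations: o u v = true means the edge {u,v} is directed from u to v.
-- For each edge of G exactly one of the two directions is chosen.

record Orientation {n} (G : Graph n) : Set where
  field
    dir   : Fin n → Fin n → Bool
    valid : ∀ u v → Adj G u v → dir v u ≡ not (dir u v)
open Orientation public

forwardCount : ∀ {n} {G : Graph n} → Orientation G → Cycle G → ℕ
forwardCount o C = length (filter (λ p → dir o (proj₁ p) (proj₂ p) Data.Bool.≟ true) (cycPairs (verts C)))
  where import Data.Bool

backwardCount : ∀ {n} {G : Graph n} → Orientation G → Cycle G → ℕ
backwardCount o C = length (filter (λ p → dir o (proj₂ p) (proj₁ p) Data.Bool.≟ true) (cycPairs (verts C)))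
  where import Data.Bool

EvenlyOriented : ∀ {n} {G : Graph n} → Orientation G → Cycle G → Set
EvenlyOriented o C = Even (forwardCount o C) × Even (backwardCount o C)

multiplicity : ∀ {n} {G : Graph n} → Fin n → Fin n → List (Cycle G) → ℕ
multiplicity u v A = length (filter (edgeOf? u v) A)

record OddFSet {n} {G : Graph n} (F : OneFactor G) : Set where
  field
    members     : List (Cycle G)
    pairwise    : AllPairs (λ C D → ¬ SameCycle C D) members
    alternating : All (Alternating F) members
    zero-sum    : ∀ u v → Adj G u v → Even (multiplicity u v members)
    odd         : Odd (length members)
open OddFSet public

SimplyBad : ∀ {n} → Graph n → Set
SimplyBad G =
  Σ (OneFactor G) λ F →
  Σ (OddFSet F) λ 𝒜 →
  Σ (Orientation G) λ o →
  All (EvenlyOriented o) (members 𝒜)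

-- The three graphs.  Vertices a,b,…,l are 0,1,…,11.

cycle12 : List (Fin 12 × Fin 12)
cycle12 = (# 0 , # 1) ∷ (# 1 , # 2) ∷ (# 2 , # 3) ∷ (# 3 , # 4) ∷ (# 4 , # 5)
        ∷ (# 5 , # 6) ∷ (# 6 , # 7) ∷ (# 7 , # 8) ∷ (# 8 , # 9) ∷ (# 9 , # 10)
        ∷ (# 10 , # 11) ∷ (# 11 , # 0) ∷ []

cubeplex : Graph 12
cubeplex = record { edges = cycle12 ++
  ((# 0 , # 3) ∷ (# 1 , # 6) ∷ (# 2 , # 8) ∷ (# 4 , # 9) ∷ (# 5 , # 11) ∷ (# 7 , # 10) ∷ []) }

twinplex : Graph 12
twinplex = record { edges = cycle12 ++
  ((# 0 , # 8) ∷ (# 1 , # 5) ∷ (# 2 , # 9) ∷ (# 3 , # 7) ∷ (# 4 , # 11) ∷ (# 6 , # 10) ∷ []) }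

K33 : Graph 6
K33 = record { edges =
    (# 0 , # 3) ∷ (# 0 , # 4) ∷ (# 0 , # 5)
  ∷ (# 1 , # 3) ∷ (# 1 , # 4) ∷ (# 1 , # 5)
  ∷ (# 2 , # 3) ∷ (# 2 , # 4) ∷ (# 2 , # 5) ∷ [] }

-- Each graph is shown simply bad by an explicit witness: a 1-factor F, an odd
-- family of five F-alternating cycles covering every edge an even number of
-- times, and an orientation in which all five cycles are evenly oriented.
-- Every condition in SimplyBad is decidable on finite data, so the witnesses
-- are verified by evaluating decision procedures.
module Submission where

open import Defs
open import Data.Nat using (zero; suc; _*_; _≤_; _≤?_)
open import Data.Nat.Properties using (+-suc; suc-injective) renaming (_≟_ to _≟ℕ_)
open import Data.Fin using (Fin; #_)
open import Data.Fin.Properties using (_≟_; all?)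
open import Data.Bool using (Bool; not)
open import Data.Bool.Properties using () renaming (_≟_ to _≟ᵇ_)
open import Data.List using (List; []; _∷_; length)
open import Data.List.Membership.Propositional using (_∈_)
open import Data.List.Membership.DecPropositional using () renaming (_∈?_ to ∈?-with)
open import Data.List.Relation.Unary.All as All using (All; []; _∷_)
open import Data.List.Relation.Unary.AllPairs using (AllPairs; allPairs?)
open import Data.List.Relation.Unary.Unique.Propositional using (Unique)
open import Data.Product using (_×_; _,_; proj₁; proj₂)
open import Data.Product.Properties using (≡-dec)
open import Data.Vec using (Vec; lookup) renaming (_∷_ to _∷ᵛ_; [] to []ᵛ)
open import Relation.Binary.PropositionalEquality using (_≡_; refl; sym; cong)
open import Relation.Nullary using (¬_; Dec; yes; no; does)
open import Relation.Nullary.Decidable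
  using (True; toWitness; map′; _⊎-dec_; _×-dec_; _→-dec_; ¬?)
open import Relation.Unary using (Decidable)

odd⇒even-suc : ∀ {m} → Odd m → Even (suc m)
odd⇒even-suc (j , refl) = suc j , cong suc (sym (+-suc j j))

even-suc⇒odd : ∀ {m} → Even (suc m) → Odd m
even-suc⇒odd (suc k , eq) rewrite +-suc k k = k , suc-injective eq

even⇒odd-suc : ∀ {m} → Even m → Odd (suc m)
even⇒odd-suc (j , eq) = j , cong suc eq

odd-suc⇒even : ∀ {m} → Odd (suc m) → Even m
odd-suc⇒even (j , eq) = j , suc-injective eq

even? : Decidable Even
odd?  : Decidable Odd

even? zero    = yes (0 , refl)
even? (suc m) = map′ odd⇒even-suc even-suc⇒odd (odd? m)

odd? zero    = no λ ()
odd? (suc m) = map′ even⇒odd-suc odd-suc⇒even (even? m)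

module Certify {n} (G : Graph n) where
  open import Data.List.Relation.Unary.Unique.DecPropositional (_≟_ {n}) using (unique?)

  private
    _∈?_ : (e : Fin n × Fin n) (es : List (Fin n × Fin n)) → Dec (e ∈ es)
    _∈?_ = ∈?-with (≡-dec _≟_ _≟_)

  adj? : ∀ u v → Dec (Adj G u v)
  adj? u v = ((u , v) ∈? edges G) ⊎-dec ((v , u) ∈? edges G)

  IsCycle : List (Fin n) → Set
  IsCycle vs = Unique vs × 3 ≤ length vs
             × All (λ e → Adj G (proj₁ e) (proj₂ e)) (cycPairs vs)

  isCycle? : Decidable IsCycle
  isCycle? vs = unique? vs ×-dec (3 ≤? length vs)
              ×-dec All.all? (λ e → adj? (proj₁ e) (proj₂ e)) (cycPairs vs)

  toCycle : ∀ vs → IsCycle vs → Cycle G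
  toCycle vs (distinct , long , adjacent) = record
    { verts = vs ; distinct = distinct ; long = long ; adjacent = adjacent }

  toCycles : ∀ vss → All IsCycle vss → List (Cycle G)
  toCycles []         []       = []
  toCycles (vs ∷ vss) (c ∷ cs) = toCycle vs c ∷ toCycles vss cs

  sameCycle? : (C D : Cycle G) → Dec (SameCycle C D)
  sameCycle? C D = all? λ u → all? λ v →
    (edgeOf? u v C →-dec edgeOf? u v D) ×-dec (edgeOf? u v D →-dec edgeOf? u v C)

  IsPartnerMap : (Fin n → Fin n) → Set
  IsPartnerMap μ = (∀ v → μ (μ v) ≡ v) × (∀ v → ¬ μ v ≡ v) × (∀ v → Adj G v (μ v))

  isPartnerMap? : Decidable IsPartnerMap
  isPartnerMap? μ = all? (λ v → μ (μ v) ≟ v) ×-dec all? (λ v → ¬? (μ v ≟ v))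
                  ×-dec all? (λ v → adj? v (μ v))

  toOneFactor : ∀ μ → IsPartnerMap μ → OneFactor G
  toOneFactor μ (involutive , no-fix , is-edge) = record
    { partner = μ ; involutive = involutive ; no-fix = no-fix ; is-edge = is-edge }

  arcsDir : List (Fin n × Fin n) → Fin n → Fin n → Bool
  arcsDir arcs u v = does ((u , v) ∈? arcs)

  IsOrientation : (Fin n → Fin n → Bool) → Set
  IsOrientation d = ∀ u v → Adj G u v → d v u ≡ not (d u v)

  isOrientation? : Decidable IsOrientation
  isOrientation? d = all? λ u → all? λ v → adj? u v →-dec (d v u ≟ᵇ not (d u v))

  toOrientation : ∀ d → IsOrientation d → Orientation G
  toOrientation d valid = record { dir = d ; valid = valid }

  IsOddFSet : OneFactor G → List (Cycle G) → Set
  IsOddFSet F A = AllPairs (λ C D → ¬ SameCycle C D) A × All (Alternating F) A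
                × (∀ u v → Adj G u v → Even (multiplicity u v A)) × Odd (length A)

  isOddFSet? : ∀ F → Decidable (IsOddFSet F)
  isOddFSet? F A = allPairs? (λ C D → ¬? (sameCycle? C D)) A
                 ×-dec All.all? (λ C → numEdges C ≟ℕ 2 * numFEdges F C) A
                 ×-dec all? (λ u → all? λ v → adj? u v →-dec even? (multiplicity u v A))
                 ×-dec odd? (length A)

  toOddFSet : ∀ F A → IsOddFSet F A → OddFSet F
  toOddFSet F A (pairwise , alternating , zero-sum , odd) = record
    { members = A ; pairwise = pairwise ; alternating = alternating
    ; zero-sum = zero-sum ; odd = odd }

  evenlyOriented? : (o : Orientation G) → Decidable (EvenlyOriented o)
  evenlyOriented? o C = even? (forwardCount o C) ×-dec even? (backwardCount o C)

  simplyBad : (partners : Vec (Fin n) n) (arcs : List (Fin n × Fin n))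
              (cycles : List (List (Fin n)))
              {μ✓ : True (isPartnerMap? (lookup partners))}
              {o✓ : True (isOrientation? (arcsDir arcs))}
              {C✓ : True (All.all? isCycle? cycles)} →
              let F = toOneFactor (lookup partners) (toWitness μ✓)
                  o = toOrientation (arcsDir arcs) (toWitness o✓)
                  A = toCycles cycles (toWitness C✓)
              in True (isOddFSet? F A) → True (All.all? (evenlyOriented? o) A) →
              SimplyBad G
  simplyBad partners arcs cycles {μ✓} {o✓} {C✓} A✓ even✓ =
    F , toOddFSet F A (toWitness {a? = isOddFSet? F A} A✓) ,
    o , toWitness {a? = All.all? (evenlyOriented? o) A} even✓
    where
    F = toOneFactor (lookup partners) (toWitness μ✓)
    o = toOrientation (arcsDir arcs) (toWitness o✓)
    A = toCycles cycles (toWitness C✓)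

cubeplex-simplyBad : SimplyBad cubeplex
cubeplex-simplyBad = Certify.simplyBad cubeplex
  (# 1 ∷ᵛ # 0 ∷ᵛ # 8 ∷ᵛ # 4 ∷ᵛ # 3 ∷ᵛ # 11 ∷ᵛ # 7 ∷ᵛ # 6 ∷ᵛ # 2 ∷ᵛ # 10 ∷ᵛ # 9 ∷ᵛ # 5 ∷ᵛ []ᵛ)
  ( (# 1 , # 0) ∷ (# 2 , # 1) ∷ (# 3 , # 2) ∷ (# 4 , # 3) ∷ (# 5 , # 4) ∷ (# 6 , # 5)
  ∷ (# 7 , # 6) ∷ (# 8 , # 7) ∷ (# 9 , # 8) ∷ (# 10 , # 9) ∷ (# 11 , # 10) ∷ (# 0 , # 11)
  ∷ (# 3 , # 0) ∷ (# 1 , # 6) ∷ (# 8 , # 2) ∷ (# 9 , # 4) ∷ (# 11 , # 5) ∷ (# 7 , # 10) ∷ [])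
  ( (# 0 ∷ # 1 ∷ # 6 ∷ # 7 ∷ # 8 ∷ # 2 ∷ # 3 ∷ # 4 ∷ # 5 ∷ # 11 ∷ [])
  ∷ (# 0 ∷ # 3 ∷ # 4 ∷ # 5 ∷ # 11 ∷ # 10 ∷ # 9 ∷ # 8 ∷ # 2 ∷ # 1 ∷ [])
  ∷ (# 0 ∷ # 1 ∷ # 2 ∷ # 8 ∷ # 9 ∷ # 10 ∷ # 7 ∷ # 6 ∷ # 5 ∷ # 11 ∷ [])
  ∷ (# 0 ∷ # 3 ∷ # 4 ∷ # 9 ∷ # 10 ∷ # 7 ∷ # 6 ∷ # 1 ∷ [])
  ∷ (# 2 ∷ # 8 ∷ # 7 ∷ # 6 ∷ # 5 ∷ # 11 ∷ # 10 ∷ # 9 ∷ # 4 ∷ # 3 ∷ [])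
  ∷ []) _ _

twinplex-simplyBad : SimplyBad twinplex
twinplex-simplyBad = Certify.simplyBad twinplex
  (# 1 ∷ᵛ # 0 ∷ᵛ # 3 ∷ᵛ # 2 ∷ᵛ # 5 ∷ᵛ # 4 ∷ᵛ # 7 ∷ᵛ # 6 ∷ᵛ # 9 ∷ᵛ # 8 ∷ᵛ # 11 ∷ᵛ # 10 ∷ᵛ []ᵛ)
  ( (# 1 , # 0) ∷ (# 2 , # 1) ∷ (# 3 , # 2) ∷ (# 4 , # 3) ∷ (# 5 , # 4) ∷ (# 6 , # 5)
  ∷ (# 7 , # 6) ∷ (# 8 , # 7) ∷ (# 9 , # 8) ∷ (# 10 , # 9) ∷ (# 11 , # 10) ∷ (# 0 , # 11)
  ∷ (# 8 , # 0) ∷ (# 5 , # 1) ∷ (# 2 , # 9) ∷ (# 7 , # 3) ∷ (# 4 , # 11) ∷ (# 6 , # 10) ∷ [])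
  ( (# 2 ∷ # 3 ∷ # 4 ∷ # 5 ∷ # 6 ∷ # 7 ∷ # 8 ∷ # 9 ∷ [])
  ∷ (# 0 ∷ # 1 ∷ # 2 ∷ # 3 ∷ # 4 ∷ # 5 ∷ # 6 ∷ # 7 ∷ # 8 ∷ # 9 ∷ # 10 ∷ # 11 ∷ [])
  ∷ (# 0 ∷ # 8 ∷ # 9 ∷ # 10 ∷ # 11 ∷ # 4 ∷ # 5 ∷ # 1 ∷ [])
  ∷ (# 0 ∷ # 8 ∷ # 9 ∷ # 2 ∷ # 3 ∷ # 7 ∷ # 6 ∷ # 10 ∷ # 11 ∷ # 4 ∷ # 5 ∷ # 1 ∷ [])
  ∷ (# 0 ∷ # 1 ∷ # 2 ∷ # 3 ∷ # 7 ∷ # 6 ∷ # 10 ∷ # 11 ∷ [])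
  ∷ []) _ _

K33-simplyBad : SimplyBad K33
K33-simplyBad = Certify.simplyBad K33
  (# 3 ∷ᵛ # 4 ∷ᵛ # 5 ∷ᵛ # 0 ∷ᵛ # 1 ∷ᵛ # 2 ∷ᵛ []ᵛ)
  ( (# 3 , # 0) ∷ (# 4 , # 0) ∷ (# 5 , # 0) ∷ (# 3 , # 1) ∷ (# 4 , # 1)
  ∷ (# 1 , # 5) ∷ (# 3 , # 2) ∷ (# 2 , # 4) ∷ (# 5 , # 2) ∷ [])
  ( (# 0 ∷ # 3 ∷ # 2 ∷ # 5 ∷ [])
  ∷ (# 0 ∷ # 3 ∷ # 1 ∷ # 4 ∷ [])
  ∷ (# 0 ∷ # 3 ∷ # 2 ∷ # 5 ∷ # 1 ∷ # 4 ∷ [])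
  ∷ (# 1 ∷ # 4 ∷ # 2 ∷ # 5 ∷ [])
  ∷ (# 0 ∷ # 3 ∷ # 1 ∷ # 4 ∷ # 2 ∷ # 5 ∷ [])
  ∷ []) _ _

lemma3p4 : SimplyBad cubeplex × SimplyBad twinplex × SimplyBad K33
lemma3p4 = cubeplex-simplyBad , twinplex-simplyBad , K33-simplyBad
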